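{- Let $n\ge1$ and $\pi\in\mathfrak M_n$. Then one of the following holds: (i) $\pi=(n,\beta)$ where $\beta\in\mathfrak M_{n-1}$; (ii) there exists $t$ with $2\le t\le n$ such that $\pi=(\alpha,n-t+1,n,\beta)$, where $\alpha=(\alpha_1,\dots,\alpha_{t-2})$ satisfies $(\alpha_1-(n-t+1),\dots,\alpha_{t-2}-(n-t+1))\in\mathfrak M_{t-2}$ and $\beta\in\mathfrak M_{n-t}$.
   Context: A permutation $\pi=\pi_1\cdots\pi_n$ is a Motzkin permutation if it avoids the pattern $132$ (no $i<j<k$ with $\pi_i<\pi_k<\pi_j$) and there are no indices $a<b$ with $\pi_a<\pi_b<\pi_{b+1}$; $\mathfrak M_n$ denotes the set of Motzkin permutations of length $n$ (with $\mathfrak M_0$ consisting of the empty permutation). The notation $(\gamma,a,b,\delta)$ denotes concatenation of sequences. -}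

module Defs where

open import Data.Nat using (ℕ; zero; suc; _<_)
open import Data.Fin using (Fin; toℕ) renaming (_<_ to _<ᶠ_)
open import Data.List using (List; length; lookup; map; upTo)
open import Data.List.Relation.Binary.Permutation.Propositional using (_↭_)
open import Data.Product using (_×_)
open import Relation.Binary.PropositionalEquality using (_≡_)
open import Relation.Nullary using (¬_)

-- Permutations of length n are lists of naturals in one-line notation,
-- a rearrangement of [1, 2, ..., n].
IsPerm : ℕ → List ℕ → Set
IsPerm n xs = xs ↭ map suc (upTo n)

Avoids132 : List ℕ → Set
Avoids132 xs = (i j k : Fin (length xs)) → i <ᶠ j → j <ᶠ k →
  ¬ (lookup xs i < lookup xs k × lookup xs k < lookup xs j)

NoRiseAfterSmaller : List ℕ → Set
NoRiseAfterSmaller xs = (a b c : Fin (length xs)) → a <ᶠ b → toℕ c ≡ suc (toℕ b) →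
  ¬ (lookup xs a < lookup xs b × lookup xs b < lookup xs c)

Motzkin : ℕ → List ℕ → Set
Motzkin n xs = IsPerm n xs × Avoids132 xs × NoRiseAfterSmaller xs

-- Write π = γ ++ n ∷ β. Avoiding 132 puts every entry of γ above every entry of β
-- (otherwise a, n, b is a 132), so β is a permutation of 1 … |β| and γ of the values
-- above it. If γ = α ++ [ x ] is nonempty, the second condition puts x below every entry
-- of α (otherwise a < x < n with x, n adjacent), so x = |β| + 1. Both conditions pass to
-- contiguous factors and are preserved by order-preserving relabelling, which gives the
-- Motzkin property of β and of α shifted down by x.
module Submission where

open import Defs
open import Data.Nat using (ℕ; zero; suc; _≤_; _<_; _∸_; _+_; z≤n; s≤s)
open import Data.Nat.Properties
open import Data.Fin using (Fin; toℕ) renaming (zero to fzero; suc to fsuc)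
open import Data.Fin.Properties using (toℕ<n)
open import Data.List using (List; []; _∷_; _++_; _∷ʳ_; [_]; map; length; lookup; upTo; applyUpTo; initLast; _∷ʳ′_)
open import Data.List.Properties using (∷-injectiveˡ; ++-identityʳ; ∷ʳ-++; map-upTo; length-++)
open import Data.List.Membership.Propositional using (_∈_)
open import Data.List.Membership.Propositional.Properties using (∈-∃++; ∈-++⁻; ∈-++⁺ˡ; ∈-++⁺ʳ)
open import Data.List.Relation.Unary.Any using (here; there; index)
open import Data.List.Relation.Unary.Any.Properties using (lookup-index)
import Data.List.Relation.Unary.All as All
open import Data.List.Relation.Unary.AllPairs using ([]; _∷_)
open import Data.List.Relation.Unary.Unique.Propositional using (Unique)
open import Data.List.Relation.Binary.Permutation.Propositional using (_↭_; ↭-refl; ↭-prep; ↭-sym; ↭-trans; ↭⇒↭ₛ)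
open import Data.List.Relation.Binary.Permutation.Propositional.Properties using (∈-resp-↭; ↭-length; shift; drop-mid; drop-∷; ++⁺ˡ; ↭-singleton-inv) renaming (map⁺ to ↭-map⁺)
open import Data.List.Relation.Binary.Permutation.Setoid.Properties using (Unique-resp-↭)
open import Data.Product using (Σ; _×_; ∃; _,_; proj₁; proj₂)
open import Data.Sum using (_⊎_; inj₁; inj₂)
open import Data.Empty using (⊥; ⊥-elim)
open import Function using (_∘_)
open import Relation.Nullary using (¬_)
open import Relation.Binary.PropositionalEquality using (_≡_; _≢_; refl; sym; trans; cong; cong₂; subst; subst₂; setoid; module ≡-Reasoning)

private
  variable
    A B : Set

∸-reflects-< : ∀ c {a b} → a ∸ c < b ∸ c → a < b
∸-reflects-< c a∸c<b∸c = ≰⇒> (λ b≤a → <⇒≱ a∸c<b∸c (∸-monoˡ-≤ c b≤a))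

interval : ℕ → ℕ → List ℕ
interval c zero    = []
interval c (suc m) = suc c ∷ interval (suc c) m

map-suc-interval : ∀ c m → map suc (interval c m) ≡ interval (suc c) m
map-suc-interval c zero    = refl
map-suc-interval c (suc m) = cong (suc (suc c) ∷_) (map-suc-interval (suc c) m)

upTo-interval : ∀ n → map suc (upTo n) ≡ interval 0 n
upTo-interval zero    = refl
upTo-interval (suc n) = cong (1 ∷_) (begin
  map suc (applyUpTo suc n)   ≡⟨ cong (map suc) (map-upTo suc n) ⟨
  map suc (map suc (upTo n))  ≡⟨ cong (map suc) (upTo-interval n) ⟩
  map suc (interval 0 n)      ≡⟨ map-suc-interval 0 n ⟩
  interval 1 n                ∎)
  where open ≡-Reasoning

length-interval : ∀ c m → length (interval c m) ≡ m
length-interval c zero    = refl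
length-interval c (suc m) = cong suc (length-interval (suc c) m)

∈-interval⁻ : ∀ {x} c m → x ∈ interval c m → c < x × x ≤ c + m
∈-interval⁻ c (suc m) (here refl) = n<1+n c , subst (suc c ≤_) (sym (+-suc c m)) (s≤s (m≤m+n c m))
∈-interval⁻ {x} c (suc m) (there x∈) with ∈-interval⁻ (suc c) m x∈
... | c<x , x≤ = <-trans (n<1+n c) c<x , subst (x ≤_) (sym (+-suc c m)) x≤

interval-unique : ∀ c m → Unique (interval c m)
interval-unique c zero    = []
interval-unique c (suc m) =
  All.tabulate (λ x∈ c+1≡x → <-irrefl c+1≡x (proj₁ (∈-interval⁻ (suc c) m x∈))) ∷ interval-unique (suc c) m

interval-∷ʳ : ∀ c m → interval c (suc m) ≡ interval c m ∷ʳ suc (c + m)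
interval-∷ʳ c zero    = cong (λ d → [ suc d ]) (sym (+-identityʳ c))
interval-∷ʳ c (suc m) =
  cong (suc c ∷_) (trans (interval-∷ʳ (suc c) m) (cong (λ d → interval (suc c) m ∷ʳ suc d) (sym (+-suc c m))))

last∈interval : ∀ c m → suc (c + m) ∈ interval c (suc m)
last∈interval c m = subst (suc (c + m) ∈_) (sym (interval-∷ʳ c m)) (∈-++⁺ʳ (interval c m) (here refl))

map-∸-interval : ∀ c d k → map (_∸ c) (interval (d + c) k) ≡ interval d k
map-∸-interval c d zero    = refl
map-∸-interval c d (suc k) = cong₂ _∷_ (m+n∸n≡m (suc d) c) (map-∸-interval c (suc d) k)

↭-interval⇒unique : ∀ {xs} c m → xs ↭ interval c m → Unique xs
↭-interval⇒unique c m p = Unique-resp-↭ (setoid ℕ) (↭⇒↭ₛ (↭-sym p)) (interval-unique c m)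

↭-interval-dropLast : ∀ c m xs ys → xs ++ suc (c + m) ∷ ys ↭ interval c (suc m) → xs ++ ys ↭ interval c m
↭-interval-dropLast c m xs ys p = subst (xs ++ ys ↭_) (++-identityʳ (interval c m))
  (drop-mid xs (interval c m) (subst (xs ++ suc (c + m) ∷ ys ↭_) (interval-∷ʳ c m) p))

nonempty⇒∈ : ∀ {k} (xs : List A) → length xs ≡ suc k → ∃ (_∈ xs)
nonempty⇒∈ (x ∷ _) _ = x , here refl

-- The least element c + 1 cannot lie in xs, as ys is nonempty and lies below xs;
-- removing it from ys leaves the same situation one step up.
↭-interval-splitBelow : ∀ c k j xs ys → length ys ≡ k → (∀ {a b} → a ∈ xs → b ∈ ys → b < a) →
  xs ++ ys ↭ interval c (k + j) → ys ↭ interval c k × xs ↭ interval (c + k) j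
↭-interval-splitBelow c zero j xs [] _ _ p =
  ↭-refl , subst₂ (λ ws d → ws ↭ interval d j) (++-identityʳ xs) (sym (+-identityʳ c)) p
↭-interval-splitBelow c (suc k) j xs ys len below p
  with ∈-++⁻ xs (∈-resp-↭ (↭-sym p) (here refl))
... | inj₁ c+1∈xs = ⊥-elim (¬∃∈ys (nonempty⇒∈ ys len))
  where
  ¬∃∈ys : ∃ (_∈ ys) → ⊥
  ¬∃∈ys (y , y∈ys) = <⇒≱ (below c+1∈xs y∈ys) (proj₁ (∈-interval⁻ c (suc k + j) (∈-resp-↭ p (∈-++⁺ʳ xs y∈ys))))
... | inj₂ c+1∈ys with ∈-∃++ c+1∈ys
... | us , vs , refl with ↭-interval-splitBelow (suc c) k j xs (us ++ vs) len′ below′ p′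
  where
  len′ : length (us ++ vs) ≡ k
  len′ = suc-injective (trans (sym (↭-length (shift (suc c) us vs))) len)
  below′ : ∀ {a b} → a ∈ xs → b ∈ us ++ vs → b < a
  below′ a∈ b∈ = below a∈ (∈-resp-↭ (↭-sym (shift (suc c) us vs)) (there b∈))
  p′ : xs ++ us ++ vs ↭ interval (suc c) (k + j)
  p′ = drop-∷ (↭-trans (↭-sym (shift (suc c) xs (us ++ vs))) (↭-trans (↭-sym (++⁺ˡ xs (shift (suc c) us vs))) p))
... | us+vs↭ , xs↭ = ↭-trans (shift (suc c) us vs) (↭-prep (suc c) us+vs↭) ,
                     subst (λ d → xs ↭ interval d j) (sym (+-suc c k)) xs↭

prefixIndex : (xs ys : List A) → Fin (length xs) → Fin (length (xs ++ ys))
prefixIndex (x ∷ xs) ys fzero    = fzero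
prefixIndex (x ∷ xs) ys (fsuc i) = fsuc (prefixIndex xs ys i)

toℕ-prefixIndex : ∀ (xs ys : List A) i → toℕ (prefixIndex xs ys i) ≡ toℕ i
toℕ-prefixIndex (x ∷ xs) ys fzero    = refl
toℕ-prefixIndex (x ∷ xs) ys (fsuc i) = cong suc (toℕ-prefixIndex xs ys i)

lookup-prefixIndex : ∀ (xs ys : List A) i → lookup (xs ++ ys) (prefixIndex xs ys i) ≡ lookup xs i
lookup-prefixIndex (x ∷ xs) ys fzero    = refl
lookup-prefixIndex (x ∷ xs) ys (fsuc i) = lookup-prefixIndex xs ys i

suffixIndex : (xs ys : List A) → Fin (length ys) → Fin (length (xs ++ ys))
suffixIndex []       ys i = i
suffixIndex (x ∷ xs) ys i = fsuc (suffixIndex xs ys i)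

toℕ-suffixIndex : ∀ (xs ys : List A) i → toℕ (suffixIndex xs ys i) ≡ length xs + toℕ i
toℕ-suffixIndex []       ys i = refl
toℕ-suffixIndex (x ∷ xs) ys i = cong suc (toℕ-suffixIndex xs ys i)

lookup-suffixIndex : ∀ (xs ys : List A) i → lookup (xs ++ ys) (suffixIndex xs ys i) ≡ lookup ys i
lookup-suffixIndex []       ys i = refl
lookup-suffixIndex (x ∷ xs) ys i = lookup-suffixIndex xs ys i

prefixIndex<suffixIndex : ∀ (xs ys : List A) i j → toℕ (prefixIndex xs ys i) < toℕ (suffixIndex xs ys j)
prefixIndex<suffixIndex xs ys i j = subst₂ _<_ (sym (toℕ-prefixIndex xs ys i)) (sym (toℕ-suffixIndex xs ys j))
  (<-≤-trans (toℕ<n i) (m≤m+n (length xs) (toℕ j)))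

mapIndex : (f : A → B) (xs : List A) → Fin (length (map f xs)) → Fin (length xs)
mapIndex f (x ∷ xs) fzero    = fzero
mapIndex f (x ∷ xs) (fsuc i) = fsuc (mapIndex f xs i)

toℕ-mapIndex : ∀ (f : A → B) xs i → toℕ (mapIndex f xs i) ≡ toℕ i
toℕ-mapIndex f (x ∷ xs) fzero    = refl
toℕ-mapIndex f (x ∷ xs) (fsuc i) = cong suc (toℕ-mapIndex f xs i)

lookup-mapIndex : ∀ (f : A → B) xs i → lookup (map f xs) i ≡ f (lookup xs (mapIndex f xs i))
lookup-mapIndex f (x ∷ xs) fzero    = refl
lookup-mapIndex f (x ∷ xs) (fsuc i) = lookup-mapIndex f xs i

AvoidsMotzkinPatterns : List ℕ → Set
AvoidsMotzkinPatterns xs = Avoids132 xs × NoRiseAfterSmaller xs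

-- The positions are shifted by a constant offset, not merely increasing, because
-- NoRiseAfterSmaller speaks about adjacent positions.
record FactorEmbedding (xs zs : List ℕ) : Set where
  field
    offset        : ℕ
    position      : Fin (length xs) → Fin (length zs)
    toℕ-position  : ∀ i → toℕ (position i) ≡ offset + toℕ i
    position-mono : ∀ i j → lookup xs i < lookup xs j → lookup zs (position i) < lookup zs (position j)

  position-< : ∀ i j → toℕ i < toℕ j → toℕ (position i) < toℕ (position j)
  position-< i j i<j = subst₂ _<_ (sym (toℕ-position i)) (sym (toℕ-position j)) (+-monoʳ-< offset i<j)

  position-suc : ∀ b c → toℕ c ≡ suc (toℕ b) → toℕ (position c) ≡ suc (toℕ (position b))
  position-suc b c c≡1+b = begin
    toℕ (position c)        ≡⟨ toℕ-position c ⟩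
    offset + toℕ c          ≡⟨ cong (offset +_) c≡1+b ⟩
    offset + suc (toℕ b)    ≡⟨ +-suc offset (toℕ b) ⟩
    suc (offset + toℕ b)    ≡⟨ cong suc (toℕ-position b) ⟨
    suc (toℕ (position b))  ∎
    where open ≡-Reasoning

  avoidsMotzkinPatterns : AvoidsMotzkinPatterns zs → AvoidsMotzkinPatterns xs
  avoidsMotzkinPatterns (avoids , noRise) =
    (λ i j k i<j j<k (xi<xk , xk<xj) → avoids (position i) (position j) (position k)
       (position-< i j i<j) (position-< j k j<k) (position-mono i k xi<xk , position-mono k j xk<xj)) ,
    (λ a b c a<b c≡1+b (xa<xb , xb<xc) → noRise (position a) (position b) (position c)
       (position-< a b a<b) (position-suc b c c≡1+b) (position-mono a b xa<xb , position-mono b c xb<xc))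

prefixEmbedding : ∀ xs ys → FactorEmbedding xs (xs ++ ys)
prefixEmbedding xs ys = record
  { offset        = 0
  ; position      = prefixIndex xs ys
  ; toℕ-position  = toℕ-prefixIndex xs ys
  ; position-mono = λ i j → subst₂ _<_ (sym (lookup-prefixIndex xs ys i)) (sym (lookup-prefixIndex xs ys j))
  }

suffixEmbedding : ∀ xs ys → FactorEmbedding ys (xs ++ ys)
suffixEmbedding xs ys = record
  { offset        = length xs
  ; position      = suffixIndex xs ys
  ; toℕ-position  = toℕ-suffixIndex xs ys
  ; position-mono = λ i j → subst₂ _<_ (sym (lookup-suffixIndex xs ys i)) (sym (lookup-suffixIndex xs ys j))
  }

mapEmbedding : ∀ f → (∀ {a b} → f a < f b → a < b) → ∀ xs → FactorEmbedding (map f xs) xs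
mapEmbedding f reflects xs = record
  { offset        = 0
  ; position      = mapIndex f xs
  ; toℕ-position  = toℕ-mapIndex f xs
  ; position-mono = λ i j → reflects ∘ subst₂ _<_ (lookup-mapIndex f xs i) (lookup-mapIndex f xs j)
  }

Unique-++⇒≢ : ∀ (xs : List A) {ys a b} → Unique (xs ++ ys) → a ∈ xs → b ∈ ys → a ≢ b
Unique-++⇒≢ (x ∷ xs) (x∉ ∷ _)  (here refl) b∈ys = All.lookup x∉ (∈-++⁺ʳ xs b∈ys)
Unique-++⇒≢ (x ∷ xs) (_ ∷ unq) (there a∈xs) b∈ys = Unique-++⇒≢ xs unq a∈xs b∈ys

Avoids132⇒¬ascentAcross : ∀ γ {z β a b} → Avoids132 (γ ++ z ∷ β) → a ∈ γ → b ∈ β → b < z → ¬ a < b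
Avoids132⇒¬ascentAcross γ {z} {β} {a} {b} avoids a∈γ b∈β b<z a<b =
  avoids (prefixIndex γ (z ∷ β) i) (suffixIndex γ (z ∷ β) fzero) (suffixIndex γ (z ∷ β) (fsuc j))
    (prefixIndex<suffixIndex γ (z ∷ β) i fzero) (position-< fzero (fsuc j) (s≤s z≤n))
    (subst₂ _<_ (sym a≡) (sym b≡) a<b , subst₂ _<_ (sym b≡) (sym (lookup-suffixIndex γ (z ∷ β) fzero)) b<z)
  where
  open FactorEmbedding (suffixEmbedding γ (z ∷ β))
  i : Fin (length γ)
  i = index a∈γ
  j : Fin (length β)
  j = index b∈β
  a≡ : lookup (γ ++ z ∷ β) (prefixIndex γ (z ∷ β) i) ≡ a
  a≡ = trans (lookup-prefixIndex γ (z ∷ β) i) (sym (lookup-index a∈γ))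
  b≡ : lookup (γ ++ z ∷ β) (suffixIndex γ (z ∷ β) (fsuc j)) ≡ b
  b≡ = trans (lookup-suffixIndex γ (z ∷ β) (fsuc j)) (sym (lookup-index b∈β))

NoRiseAfterSmaller⇒¬ascentBefore : ∀ α {x z β a} → NoRiseAfterSmaller (α ++ x ∷ z ∷ β) → a ∈ α → x < z → ¬ a < x
NoRiseAfterSmaller⇒¬ascentBefore α {x} {z} {β} {a} noRise a∈α x<z a<x =
  noRise (prefixIndex α (x ∷ z ∷ β) i) (suffixIndex α (x ∷ z ∷ β) fzero) (suffixIndex α (x ∷ z ∷ β) (fsuc fzero))
    (prefixIndex<suffixIndex α (x ∷ z ∷ β) i fzero) (position-suc fzero (fsuc fzero) refl)
    (subst₂ _<_ (sym a≡) (sym x≡) a<x , subst₂ _<_ (sym x≡) (sym (lookup-suffixIndex α (x ∷ z ∷ β) (fsuc fzero))) x<z)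
  where
  open FactorEmbedding (suffixEmbedding α (x ∷ z ∷ β))
  i : Fin (length α)
  i = index a∈α
  a≡ : lookup (α ++ x ∷ z ∷ β) (prefixIndex α (x ∷ z ∷ β) i) ≡ a
  a≡ = trans (lookup-prefixIndex α (x ∷ z ∷ β) i) (sym (lookup-index a∈α))
  x≡ : lookup (α ++ x ∷ z ∷ β) (suffixIndex α (x ∷ z ∷ β) fzero) ≡ x
  x≡ = lookup-suffixIndex α (x ∷ z ∷ β) fzero

↭-interval-splitAtLast : ∀ {m} α x β → (∀ {a b} → a ∈ α ∷ʳ x → b ∈ β → b < a) → (∀ {a} → a ∈ α → x < a) →
  (α ∷ʳ x) ++ β ↭ interval 0 m →
  m ≡ suc (length α + length β) × x ≡ suc (length β) ×
  α ↭ interval (suc (length β)) (length α) × β ↭ interval 0 (length β)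
↭-interval-splitAtLast {m} α x β β<γ x<α p =
  trans m≡k+|γ| (trans (cong (k +_) length-γ) (+-comm k (suc L))) ,
  ∷-injectiveˡ (↭-singleton-inv [x]↭) ,
  subst (λ c → α ↭ interval c L) (+-comm k 1) α↭ ,
  β↭
  where
  γ : List ℕ
  γ = α ∷ʳ x
  L : ℕ
  L = length α
  k : ℕ
  k = length β
  length-γ : length γ ≡ suc L
  length-γ = trans (length-++ α) (+-comm L 1)
  m≡k+|γ| : m ≡ k + length γ
  m≡k+|γ| = begin
    m                          ≡⟨ length-interval 0 m ⟨
    length (interval 0 m)      ≡⟨ ↭-length p ⟨
    length (γ ++ β)            ≡⟨ length-++ γ ⟩
    length γ + k               ≡⟨ +-comm (length γ) k ⟩
    k + length γ               ∎
    where open ≡-Reasoning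
  β↭,γ↭ : β ↭ interval 0 k × γ ↭ interval k (length γ)
  β↭,γ↭ = ↭-interval-splitBelow 0 k (length γ) γ β refl β<γ (subst (λ d → γ ++ β ↭ interval 0 d) m≡k+|γ| p)
  β↭ : β ↭ interval 0 k
  β↭ = proj₁ β↭,γ↭
  γ↭ : γ ↭ interval k (1 + L)
  γ↭ = subst (λ d → γ ↭ interval k d) length-γ (proj₂ β↭,γ↭)
  x<α′ : ∀ {a b} → a ∈ α → b ∈ [ x ] → b < a
  x<α′ a∈ (here refl) = x<α a∈
  [x]↭,α↭ : [ x ] ↭ interval k 1 × α ↭ interval (k + 1) L
  [x]↭,α↭ = ↭-interval-splitBelow k 1 L α [ x ] refl x<α′ γ↭
  [x]↭ : [ x ] ↭ [ suc k ]
  [x]↭ = proj₁ [x]↭,α↭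
  α↭ : α ↭ interval (k + 1) L
  α↭ = proj₂ [x]↭,α↭

IsPerm⇒↭-interval : ∀ {n xs} → IsPerm n xs → xs ↭ interval 0 n
IsPerm⇒↭-interval {n} {xs} = subst (xs ↭_) (upTo-interval n)

↭-interval⇒IsPerm : ∀ {n xs} → xs ↭ interval 0 n → IsPerm n xs
↭-interval⇒IsPerm {n} {xs} = subst (xs ↭_) (sym (upTo-interval n))

Motzkin-dropLeadingMax : ∀ m β → Motzkin (suc m) (suc m ∷ β) → Motzkin m β
Motzkin-dropLeadingMax m β (perm , avoids) =
  ↭-interval⇒IsPerm (↭-interval-dropLast 0 m [] β (IsPerm⇒↭-interval perm)) ,
  FactorEmbedding.avoidsMotzkinPatterns (suffixEmbedding [ suc m ] β) avoids

Motzkin-separatedAtMax : ∀ m α x β → Motzkin (suc m) ((α ∷ʳ x) ++ suc m ∷ β) →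
  (∀ {a b} → a ∈ α ∷ʳ x → b ∈ β → b < a) × (∀ {a} → a ∈ α → x < a)
Motzkin-separatedAtMax m α x β (perm , avoids132 , noRise) = β<γ , x<α
  where
  γ : List ℕ
  γ = α ∷ʳ x
  π≡ : γ ++ suc m ∷ β ≡ α ++ x ∷ suc m ∷ β
  π≡ = ∷ʳ-++ α x (suc m ∷ β)
  π↭ : γ ++ suc m ∷ β ↭ interval 0 (suc m)
  π↭ = IsPerm⇒↭-interval perm
  unique : Unique (γ ++ suc m ∷ β)
  unique = ↭-interval⇒unique 0 (suc m) π↭
  <max : ∀ {b} → b ∈ γ ++ β → b < suc m
  <max b∈ = s≤s (proj₂ (∈-interval⁻ 0 m (∈-resp-↭ (↭-interval-dropLast 0 m γ β π↭) b∈)))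
  β<γ : ∀ {a b} → a ∈ γ → b ∈ β → b < a
  β<γ a∈ b∈ = ≤∧≢⇒< (≮⇒≥ (Avoids132⇒¬ascentAcross γ avoids132 a∈ b∈ (<max (∈-++⁺ʳ γ b∈))))
                     (λ b≡a → Unique-++⇒≢ γ unique a∈ (there b∈) (sym b≡a))
  x<α : ∀ {a} → a ∈ α → x < a
  x<α a∈ = ≤∧≢⇒< (≮⇒≥ (NoRiseAfterSmaller⇒¬ascentBefore α (subst NoRiseAfterSmaller π≡ noRise) a∈ x<max))
                  (λ x≡a → Unique-++⇒≢ α (subst Unique π≡ unique) a∈ (here refl) (sym x≡a))
    where
    x<max : x < suc m
    x<max = <max (∈-++⁺ˡ (∈-++⁺ʳ α (here refl)))

Motzkin-splitAtMax : ∀ m α x β → Motzkin (suc m) ((α ∷ʳ x) ++ suc m ∷ β) →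
  m ≡ suc (length α + length β) × x ≡ suc (length β) ×
  Motzkin (length α) (map (_∸ suc (length β)) α) × Motzkin (length β) β
Motzkin-splitAtMax m α x β mot@(perm , avoids) with Motzkin-separatedAtMax m α x β mot
... | β<γ , x<α with ↭-interval-splitAtLast α x β β<γ x<α (↭-interval-dropLast 0 m (α ∷ʳ x) β (IsPerm⇒↭-interval perm))
... | m≡ , refl , α↭ , β↭ =
  m≡ , refl ,
  (↭-interval⇒IsPerm α′↭ , avoidsα′) ,
  (↭-interval⇒IsPerm β↭ , avoidsβ)
  where
  k : ℕ
  k = length β
  α′↭ : map (_∸ suc k) α ↭ interval 0 (length α)
  α′↭ = subst (map (_∸ suc k) α ↭_) (map-∸-interval (suc k) 0 (length α)) (↭-map⁺ (_∸ suc k) α↭)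
  avoidsα′ : AvoidsMotzkinPatterns (map (_∸ suc k) α)
  avoidsα′ = FactorEmbedding.avoidsMotzkinPatterns (mapEmbedding (_∸ suc k) (∸-reflects-< (suc k)) α)
               (FactorEmbedding.avoidsMotzkinPatterns (prefixEmbedding α (suc k ∷ suc m ∷ β))
                 (subst AvoidsMotzkinPatterns (∷ʳ-++ α (suc k) (suc m ∷ β)) avoids))
  avoidsβ : AvoidsMotzkinPatterns β
  avoidsβ = FactorEmbedding.avoidsMotzkinPatterns (suffixEmbedding [ suc m ] β)
              (FactorEmbedding.avoidsMotzkinPatterns (suffixEmbedding (α ∷ʳ suc k) (suc m ∷ β)) avoids)

lemma3p1 : (n : ℕ) → 1 ≤ n → (π : List ℕ) → Motzkin n π →
    (Σ (List ℕ) λ β → π ≡ n ∷ β × Motzkin (n ∸ 1) β)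
    ⊎ (Σ ℕ λ t → Σ (List ℕ) λ α → Σ (List ℕ) λ β →
        2 ≤ t × t ≤ n × length α ≡ t ∸ 2
        × π ≡ α ++ ((n ∸ t) + 1) ∷ n ∷ β
        × Motzkin (t ∸ 2) (map (λ a → a ∸ ((n ∸ t) + 1)) α)
        × Motzkin (n ∸ t) β)
lemma3p1 (suc m) _ π mot@(perm , _)
  with ∈-∃++ (∈-resp-↭ (↭-sym (IsPerm⇒↭-interval perm)) (last∈interval 0 m))
... | γ , β , refl with initLast γ
... | [] = inj₁ (β , refl , Motzkin-dropLeadingMax m β mot)
... | α ∷ʳ′ x with Motzkin-splitAtMax m α x β mot
... | refl , refl , motα , motβ =
  inj₂ (2 + L , α , β , s≤s (s≤s z≤n) , s≤s (s≤s (m≤m+n L k)) , refl ,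
        trans (∷ʳ-++ α (suc k) _) (cong (λ y → α ++ y ∷ suc (suc (L + k)) ∷ β) x≡) ,
        subst (λ y → Motzkin L (map (_∸ y) α)) x≡ motα ,
        subst (λ d → Motzkin d β) (sym n∸t≡k) motβ)
  where
  L : ℕ
  L = length α
  k : ℕ
  k = length β
  n∸t≡k : suc (suc (L + k)) ∸ (2 + L) ≡ k
  n∸t≡k = m+n∸m≡n L k
  x≡ : suc k ≡ (suc (suc (L + k)) ∸ (2 + L)) + 1
  x≡ = trans (+-comm 1 k) (cong (_+ 1) (sym n∸t≡k))
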